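{- Let $q\ge q_{0}$ (for a suitable absolute constant $q_0$), and let $N,N_{1}$ be integers with $N_{1}\le q$ and $1<N<N_{1}\le cN$, where $c>1$ is an absolute constant. Let $I_{q}(N)$ be the number of solutions of the system \[ \begin{cases}\overline{x}_{1}+\overline{x}_{2}\equiv \overline{y}_{1}+\overline{y}_{2}\pmod{q},\\ x_{1}+x_{2}\equiv y_{1}+y_{2}\pmod{q}\end{cases} \] in integers $x_1,x_2,y_1,y_2$ coprime to $q$ with $N<x_{1},x_{2},y_{1},y_{2}\le N_{1}$. Then \[ I_{q}(N)<(2c)^{3}\,2^{\omega(q)}\tau_{3}(q)N^{2}. \]
   Context: For $x$ coprime to $q$, $\overline{x}$ denotes the inverse of $x$ modulo $q$. $\omega(q)$ is the number of distinct prime divisors of $q$, and $\tau_3(q)$ is the number of ordered triples of positive integers $(d_1,d_2,d_3)$ with $d_1d_2d_3=q$.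
   Formalization: The absolute constant $c$ is taken to be rational. -}

module Defs where

open import Data.Nat using (ℕ; zero; suc; _+_; _*_; _∸_; NonZero; _≟_)
open import Data.Nat.DivMod using (_%_)
open import Data.Nat.Coprimality using (Coprime; coprime?)
open import Data.Nat.Divisibility using (_∣?_)
open import Data.Nat.Primality using (prime?)
open import Data.List using (List; []; _∷_; length; filter; applyUpTo; concatMap; map)
open import Data.Product using (_×_; _,_)
open import Relation.Nullary using (Dec; yes; no; _×-dec_)
open import Relation.Binary.PropositionalEquality using (_≡_)
open import Data.Integer using (+_)
open import Data.Rational using (ℚ; _/_)

toℚ : ℕ → ℚ
toℚ n = + n / 1

range : ℕ → ℕ → List ℕ
range N N₁ = applyUpTo (λ i → suc (N + i)) (N₁ ∸ N)

_≡_[mod_] : ℕ → ℕ → (q : ℕ) → .{{NonZero q}} → Set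
a ≡ b [mod q ] = a % q ≡ b % q

-- modular inverse: the least y ∈ [0, q) with x * y ≡ 1 (mod q)
-- (for x coprime to q this is the unique inverse residue in [0,q); value 0 otherwise, never used)
invSearch : (q x : ℕ) → .{{NonZero q}} → ℕ → ℕ → ℕ
invSearch q x y zero = 0
invSearch q x y (suc k) with (x * y) % q ≟ 1 % q
... | yes _ = y
... | no _ = invSearch q x (suc y) k

inv : (q x : ℕ) → .{{NonZero q}} → ℕ
inv q x = invSearch q x 0 q

Sol : (q : ℕ) → .{{NonZero q}} → ℕ × ℕ × ℕ × ℕ → Set
Sol q (x₁ , x₂ , y₁ , y₂) =
  ((Coprime x₁ q × Coprime x₂ q) × (Coprime y₁ q × Coprime y₂ q)) ×
  (((inv q x₁ + inv q x₂) ≡ (inv q y₁ + inv q y₂) [mod q ]) ×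
   ((x₁ + x₂) ≡ (y₁ + y₂) [mod q ]))

sol? : (q : ℕ) → .{{_ : NonZero q}} → (t : ℕ × ℕ × ℕ × ℕ) → Dec (Sol q t)
sol? q (x₁ , x₂ , y₁ , y₂) =
  ((coprime? x₁ q ×-dec coprime? x₂ q) ×-dec (coprime? y₁ q ×-dec coprime? y₂ q)) ×-dec
  ((((inv q x₁ + inv q x₂) % q) ≟ ((inv q y₁ + inv q y₂) % q)) ×-dec
   (((x₁ + x₂) % q) ≟ ((y₁ + y₂) % q)))

quads : ℕ → ℕ → List (ℕ × ℕ × ℕ × ℕ)
quads N N₁ =
  concatMap (λ x₁ → concatMap (λ x₂ → concatMap (λ y₁ →
    map (λ y₂ → (x₁ , x₂ , y₁ , y₂)) (range N N₁)) (range N N₁)) (range N N₁)) (range N N₁)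

-- I_q(N) (with the upper endpoint N₁ made explicit)
I : (q : ℕ) → .{{NonZero q}} → ℕ → ℕ → ℕ
I q N N₁ = length (filter (sol? q) (quads N N₁))

ω : ℕ → ℕ
ω q = length (filter (λ p → prime? p ×-dec (p ∣? q)) (applyUpTo (λ i → i) (suc q)))

-- τ₃(q): number of ordered triples (d₁,d₂,d₃) of positive integers with d₁ d₂ d₃ = q
-- (for q ≥ 1 every such dᵢ lies in [1, q])
τ₃ : ℕ → ℕ
τ₃ q = length (filter (λ t → proj t ≟ q)
  (concatMap (λ a → concatMap (λ b → map (λ c → (a , b , c)) (applyUpTo suc q))
    (applyUpTo suc q)) (applyUpTo suc q)))
  where
  proj : ℕ × ℕ × ℕ → ℕ
  proj (a , b , c) = a * b * c

module Submission where

-- Writing x̄ for inverses modulo q, the congruence x̄₁ + x̄₂ ≡ ȳ₁ + ȳ₂ becomes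
-- (x₁ + x₂) y₁ y₂ ≡ (y₁ + y₂) x₁ x₂, and substituting y₂ ≡ x₁ + x₂ − y₁ turns it into
-- q ∣ (x₁ + x₂)(y₁ − x₁)(x₂ − y₁). Splitting q = d₁ d₂ d₃ along these three factors, a solution
-- is determined by (x₁ + x₂, y₁ − x₁, y₁ − x₂), since y₂ ≤ N₁ ≤ q is fixed modulo q; for a fixed
-- factorisation these coordinates lie in progressions of differences d₁, d₂, d₃ inside intervals
-- of length 2N₁, which leaves at most 16 N₁² possibilities. Hence
-- I ≤ 16 τ₃(q) N₁² ≤ 16 c² τ₃(q) N² < (2c)³ 2^ω(q) τ₃(q) N² as soon as 2^ω(q) ≥ 2.

open import Algebra.Properties.CommutativeSemigroup using (interchange)
open import Data.Integer as ℤ using (ℤ; +_; 1ℤ; _⊖_; +≤+; +<+)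
open import Data.Integer.Divisibility.Signed as ℤ using (∣m∣n⇒∣m+n; ∣m∣n⇒∣m-n; ∣n⇒∣m*n; ∣⇒∣ᵤ)
open import Data.Integer.Properties as ℤ using (pos-+; pos-*; m-n≡m⊖n; ∣⊖∣-≤; ∣m⊖n∣≡∣n⊖m∣; abs-*)
import Data.Integer.Tactic.RingSolver as ℤ-Solver
open import Data.List using (List; []; _∷_; _++_; length; map; concatMap; cartesianProduct; applyUpTo; upTo; filter)
open import Data.List.Membership.Propositional using (_∈_; lose)
open import Data.List.Membership.Propositional.Properties
  using (∈-∃++; ∈-++⁻; ∈-++⁺ˡ; ∈-++⁺ʳ; ∈-map⁺; ∈-map⁻; ∈-upTo⁺; ∈-applyUpTo⁺; ∈-applyUpTo⁻;
         ∈-cartesianProduct⁺; ∈-cartesianProduct⁻; ∈-filter⁺; ∈-filter⁻; ∈-concatMap⁺)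
open import Data.List.Properties using (length-++; length-map; length-upTo; map-++; map-∘; map-id; concatMap-cong)
open import Data.List.Relation.Binary.Subset.Propositional using (_⊆_)
import Data.List.Relation.Unary.All as All
import Data.List.Relation.Unary.All.Properties as All
import Data.List.Relation.Unary.AllPairs as AllPairs
open import Data.List.Relation.Unary.Any using (here; there)
open import Data.List.Relation.Unary.Unique.Propositional using (Unique)
open import Data.List.Relation.Unary.Unique.Propositional.Properties using (applyUpTo⁺₁; cartesianProduct⁺; filter⁺)
open import Data.Maybe using (nothing)
open import Data.Nat
open import Data.Nat.Coprimality as Coprime using (Coprime; 1-coprimeTo; coprime-Bézout; coprime-/gcd; coprime-divisor)
open import Data.Nat.DivMod
open import Data.Nat.Divisibility using (_∣_; _∣?_; divides; >⇒∤; ∣⇒≤; 0∣⇒≡0; m∣m*n; n∣m*n; ∣m⇒∣m*n; *-cancelˡ-∣)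
open import Data.Nat.GCD using (gcd; gcd[m,n]∣m; gcd[m,n]∣n; gcd[m,n]≢0; module Bézout)
open import Data.Nat.ListAction using (product)
open import Data.Nat.Primality using (Prime; prime?)
open import Data.Nat.Primality.Factorisation using (factorise)
open import Data.Nat.Properties
open import Data.Nat.Tactic.RingSolver using (solve-∀; solve)
open import Data.Product using (Σ; ∃; _×_; _,_; proj₂)
open import Data.Product.Properties using (,-injective)
open import Data.Rational as ℚ using (ℚ; mkℚ; 0ℚ; 1ℚ; *≤*; *<*; Positive; NonNegative)
open import Data.Rational.Properties as ℚ
  using (normalize-coprime; +-*-commutativeRing; *-monoˡ-≤-nonNeg; *-monoʳ-≤-nonNeg; *-monoˡ-<-pos; *-monoʳ-<-pos;
         pos*pos⇒pos; pos⇒nonNeg)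
open import Data.Sum using (inj₁; inj₂)
open import Level using (Level; 0ℓ)
open import Relation.Binary.PropositionalEquality
open import Relation.Nullary using (yes; no; contradiction; _×-dec_)
open import Tactic.RingSolver as Ring using ()
open import Tactic.RingSolver.Core.AlmostCommutativeRing using (AlmostCommutativeRing; fromCommutativeRing)

open import Defs

private variable
  ℓ : Level
  A B C : Set ℓ

Unique-⊆⇒length-≤ : ∀ {xs ys : List A} → Unique xs → xs ⊆ ys → length xs ≤ length ys
Unique-⊆⇒length-≤ {xs = []} _ _ = z≤n
Unique-⊆⇒length-≤ {xs = x ∷ xs} {ys} (x∉xs AllPairs.∷ xs!) xs⊆ys with ∈-∃++ (xs⊆ys (here refl))
... | ys₁ , ys₂ , refl = begin
  suc (length xs)                ≤⟨ s≤s (Unique-⊆⇒length-≤ xs! xs⊆ys₁++ys₂) ⟩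
  suc (length (ys₁ ++ ys₂))      ≡⟨ cong suc (length-++ ys₁) ⟩
  suc (length ys₁ + length ys₂)  ≡⟨ +-suc (length ys₁) (length ys₂) ⟨
  length ys₁ + length (x ∷ ys₂)  ≡⟨ length-++ ys₁ ⟨
  length (ys₁ ++ x ∷ ys₂)        ∎
  where
  open ≤-Reasoning
  xs⊆ys₁++ys₂ : xs ⊆ ys₁ ++ ys₂
  xs⊆ys₁++ys₂ {z} z∈xs with ∈-++⁻ ys₁ (xs⊆ys (there z∈xs))
  ... | inj₁ z∈ys₁         = ∈-++⁺ˡ z∈ys₁
  ... | inj₂ (here refl)   = contradiction refl (All.lookup x∉xs z∈xs)
  ... | inj₂ (there z∈ys₂) = ∈-++⁺ʳ ys₁ z∈ys₂

map⁺-injectiveOn : ∀ {f : A → B} {xs} → Unique xs →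
  (∀ {u v} → u ∈ xs → v ∈ xs → f u ≡ f v → u ≡ v) → Unique (map f xs)
map⁺-injectiveOn {xs = []} _ _ = AllPairs.[]
map⁺-injectiveOn {xs = x ∷ xs} (x∉xs AllPairs.∷ xs!) inj =
  All.map⁺ (All.tabulate λ y∈xs fx≡fy → All.lookup x∉xs y∈xs (inj (here refl) (there y∈xs) fx≡fy))
  AllPairs.∷ map⁺-injectiveOn xs! (λ u∈ v∈ → inj (there u∈) (there v∈))

length-≤-injectiveOn : ∀ {f : A → B} {xs ys} → Unique xs →
  (∀ {x} → x ∈ xs → f x ∈ ys) → (∀ {u v} → u ∈ xs → v ∈ xs → f u ≡ f v → u ≡ v) →
  length xs ≤ length ys
length-≤-injectiveOn {f = f} {xs} {ys} xs! f∈ys inj = begin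
  length xs          ≡⟨ length-map f xs ⟨
  length (map f xs)  ≤⟨ Unique-⊆⇒length-≤ (map⁺-injectiveOn xs! inj) image⊆ys ⟩
  length ys          ∎
  where
  open ≤-Reasoning
  image⊆ys : map f xs ⊆ ys
  image⊆ys p with x , x∈xs , refl ← ∈-map⁻ f p = f∈ys x∈xs

∈⇒1≤length : ∀ {x : A} {xs} → x ∈ xs → 1 ≤ length xs
∈⇒1≤length {xs = _ ∷ _} _ = s≤s z≤n

length-concatMap-≤ : ∀ {f : A → List B} K xs → (∀ {x} → x ∈ xs → length (f x) ≤ K) →
                     length (concatMap f xs) ≤ length xs * K
length-concatMap-≤ K [] _ = z≤n
length-concatMap-≤ {f = f} K (x ∷ xs) bound = begin
  length (f x ++ concatMap f xs)           ≡⟨ length-++ (f x) ⟩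
  length (f x) + length (concatMap f xs)   ≤⟨ +-mono-≤ (bound (here refl)) (length-concatMap-≤ K xs (λ p → bound (there p))) ⟩
  K + length xs * K                        ∎
  where open ≤-Reasoning

length-cartesianProduct : ∀ (xs : List A) (ys : List B) → length (cartesianProduct xs ys) ≡ length xs * length ys
length-cartesianProduct []       ys = refl
length-cartesianProduct (x ∷ xs) ys = begin
  length (map (x ,_) ys ++ cartesianProduct xs ys)
    ≡⟨ length-++ (map (x ,_) ys) ⟩
  length (map (x ,_) ys) + length (cartesianProduct xs ys)
    ≡⟨ cong₂ _+_ (length-map (x ,_) ys) (length-cartesianProduct xs ys) ⟩
  length ys + length xs * length ys ∎
  where open ≡-Reasoning

concatMap-map≡map-cartesianProduct : ∀ (g : A × B → C) xs ys →
  concatMap (λ x → map (λ y → g (x , y)) ys) xs ≡ map g (cartesianProduct xs ys)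
concatMap-map≡map-cartesianProduct g []       ys = refl
concatMap-map≡map-cartesianProduct g (x ∷ xs) ys = begin
  map (λ y → g (x , y)) ys ++ concatMap (λ x → map (λ y → g (x , y)) ys) xs
    ≡⟨ cong₂ _++_ (map-∘ ys) (concatMap-map≡map-cartesianProduct g xs ys) ⟩
  map g (map (x ,_) ys) ++ map g (cartesianProduct xs ys)
    ≡⟨ map-++ g (map (x ,_) ys) (cartesianProduct xs ys) ⟨
  map g (map (x ,_) ys ++ cartesianProduct xs ys) ∎
  where open ≡-Reasoning

cube : List ℕ → List (ℕ × ℕ × ℕ)
cube xs = cartesianProduct xs (cartesianProduct xs xs)

quads≡cartesianProduct : ∀ N N₁ → quads N N₁ ≡ cartesianProduct (range N N₁) (cube (range N N₁))
quads≡cartesianProduct N N₁ = trans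
  (concatMap-cong (λ x₁ → trans
     (concatMap-cong (λ x₂ → concatMap-map≡map-cartesianProduct (λ p → x₁ , x₂ , p) R R) R)
     (concatMap-map≡map-cartesianProduct (x₁ ,_) R (cartesianProduct R R))) R)
  (trans (concatMap-map≡map-cartesianProduct (λ p → p) R (cube R)) (map-id _))
  where
  R : List ℕ
  R = range N N₁

triples : List ℕ → List (ℕ × ℕ × ℕ)
triples xs = concatMap (λ a → concatMap (λ b → map (λ c → a , b , c) xs) xs) xs

triples≡cube : ∀ xs → triples xs ≡ cube xs
triples≡cube xs = trans
  (concatMap-cong (λ a → concatMap-map≡map-cartesianProduct (a ,_) xs xs) xs)
  (trans (concatMap-map≡map-cartesianProduct (λ p → p) xs (cartesianProduct xs xs)) (map-id _))

factorisations : ℕ → List (ℕ × ℕ × ℕ)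
factorisations q = filter (λ (a , b , c) → a * b * c ≟ q) (triples (applyUpTo suc q))

∈-range⁻ : ∀ {N N₁ x} → x ∈ range N N₁ → N < x × x ≤ N₁
∈-range⁻ {N} {N₁} x∈ with i , i<N₁∸N , refl ← ∈-applyUpTo⁻ (λ i → suc (N + i)) x∈ =
  s≤s (m≤m+n N i) ,
  subst (_≤ N₁) (trans (+-comm (suc i) N) (+-suc N i)) (m≤o∸n⇒m+n≤o (suc i) N≤N₁ i<N₁∸N)
  where
  N≤N₁ : N ≤ N₁
  N≤N₁ = <⇒≤ (m∸n≢0⇒n<m (λ N₁∸N≡0 → contradiction (subst (i <_) N₁∸N≡0 i<N₁∸N) λ ()))

Unique-range : ∀ N N₁ → Unique (range N N₁)
Unique-range N N₁ = applyUpTo⁺₁ (λ i → suc (N + i)) (N₁ ∸ N)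
  (λ i<j _ eq → <⇒≢ i<j (+-cancelˡ-≡ N _ _ (suc-injective eq)))

Unique-quads : ∀ N N₁ → Unique (quads N N₁)
Unique-quads N N₁ = subst Unique (sym (quads≡cartesianProduct N N₁))
  (cartesianProduct⁺ R! (cartesianProduct⁺ R! (cartesianProduct⁺ R! R!)))
  where
  R! : Unique (range N N₁)
  R! = Unique-range N N₁

∈-quads⁻ : ∀ {N N₁ x₁ x₂ y₁ y₂} → (x₁ , x₂ , y₁ , y₂) ∈ quads N N₁ →
  x₁ ∈ range N N₁ × x₂ ∈ range N N₁ × y₁ ∈ range N N₁ × y₂ ∈ range N N₁
∈-quads⁻ {N} {N₁} w∈
  with x₁∈ , p∈ ← ∈-cartesianProduct⁻ (range N N₁) (cube (range N N₁)) (subst (_ ∈_) (quads≡cartesianProduct N N₁) w∈)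
  with x₂∈ , p′∈ ← ∈-cartesianProduct⁻ (range N N₁) (cartesianProduct (range N N₁) (range N N₁)) p∈
  with y₁∈ , y₂∈ ← ∈-cartesianProduct⁻ (range N N₁) (range N N₁) p′∈ = x₁∈ , x₂∈ , y₁∈ , y₂∈

∣⇒∈-applyUpTo-suc : ∀ {d q} .{{_ : NonZero q}} → d ∣ q → d ∈ applyUpTo suc q
∣⇒∈-applyUpTo-suc {zero}  {q} 0∣q = contradiction (0∣⇒≡0 0∣q) (≢-nonZero⁻¹ q)
∣⇒∈-applyUpTo-suc {suc _}     d∣q = ∈-applyUpTo⁺ suc (∣⇒≤ d∣q)

∈-factorisations⁺ : ∀ {d₁ d₂ d₃ q} .{{_ : NonZero q}} → d₁ * d₂ * d₃ ≡ q → (d₁ , d₂ , d₃) ∈ factorisations q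
∈-factorisations⁺ {d₁} {d₂} {d₃} {q} d₁d₂d₃≡q =
  ∈-filter⁺ (λ (a , b , c) → a * b * c ≟ q)
    (subst ((d₁ , d₂ , d₃) ∈_) (sym (triples≡cube (applyUpTo suc q)))
      (∈-cartesianProduct⁺ (∈[1,q] (∣m⇒∣m*n d₃ (m∣m*n d₂)))
        (∈-cartesianProduct⁺ (∈[1,q] (∣m⇒∣m*n d₃ (n∣m*n d₁))) (∈[1,q] (n∣m*n (d₁ * d₂))))))
    d₁d₂d₃≡q
  where
  ∈[1,q] : ∀ {d} → d ∣ d₁ * d₂ * d₃ → d ∈ applyUpTo suc q
  ∈[1,q] d∣ = ∣⇒∈-applyUpTo-suc (subst (_ ∣_) d₁d₂d₃≡q d∣)

∈-factorisations⁻ : ∀ {d₁ d₂ d₃ q} → (d₁ , d₂ , d₃) ∈ factorisations q → d₁ * d₂ * d₃ ≡ q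
∈-factorisations⁻ {q = q} t∈ = proj₂ (∈-filter⁻ (λ (a , b , c) → a * b * c ≟ q) {xs = triples (applyUpTo suc q)} t∈)

m*n≤o⇒m≤o/n : ∀ m {n o} .{{_ : NonZero n}} → m * n ≤ o → m ≤ o / n
m*n≤o⇒m≤o/n m {n} {o} m*n≤o = subst (_≤ o / n) (m*n/n≡m m n) (/-monoˡ-≤ n m*n≤o)

m*n≡o⇒m≢0 : ∀ m {n o} .{{_ : NonZero o}} → m * n ≡ o → NonZero m
m*n≡o⇒m≢0 m {o = o} {{o≢0}} m*n≡o = m*n≢0⇒m≢0 m {{subst NonZero (sym m*n≡o) o≢0}}

m*n≡o⇒n≢0 : ∀ m {n o} .{{_ : NonZero o}} → m * n ≡ o → NonZero n
m*n≡o⇒n≢0 m {o = o} {{o≢0}} m*n≡o = m*n≢0⇒n≢0 m {{subst NonZero (sym m*n≡o) o≢0}}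

m∣n∧n<m⇒n≡0 : ∀ {m n} → m ∣ n → n < m → n ≡ 0
m∣n∧n<m⇒n≡0 {n = zero}  _   _   = refl
m∣n∧n<m⇒n≡0 {n = suc n} m∣n n<m = contradiction m∣n (>⇒∤ n<m)

m+n≤m*n+1 : ∀ {m n} → 1 ≤ m → 1 ≤ n → m + n ≤ m * n + 1
m+n≤m*n+1 {suc m} {suc n} (s≤s _) (s≤s _) = begin
  suc m + suc n          ≤⟨ m≤m+n (suc m + suc n) (m * n) ⟩
  suc m + suc n + m * n  ≡⟨ solve (m ∷ n ∷ []) ⟩
  suc m * suc n + 1      ∎
  where open ≤-Reasoning

m+n≤m*n : ∀ {m n} → 2 ≤ m → 2 ≤ n → m + n ≤ m * n
m+n≤m*n {suc (suc m)} {suc (suc n)} (s≤s (s≤s _)) (s≤s (s≤s _)) = begin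
  2 + m + (2 + n)                    ≤⟨ m≤m+n (2 + m + (2 + n)) (m + n + m * n) ⟩
  2 + m + (2 + n) + (m + n + m * n)  ≡⟨ solve (m ∷ n ∷ []) ⟩
  (2 + m) * (2 + n)                  ∎
  where open ≤-Reasoning

[2M+a]*[2M+b]≤8Mq : ∀ {M a b q} → 1 ≤ a → 1 ≤ b → a * b ≤ q → 1 ≤ M → M ≤ q → 2 ≤ q →
                    (2 * M + a) * (2 * M + b) ≤ 8 * (M * q)
[2M+a]*[2M+b]≤8Mq {M} {a} {b} {q} 1≤a 1≤b ab≤q 1≤M M≤q 2≤q = begin
  (2 * M + a) * (2 * M + b)                  ≡⟨ solve (M ∷ a ∷ b ∷ []) ⟩
  4 * (M * M) + 2 * M * (a + b) + a * b      ≤⟨ +-mono-≤ (+-mono-≤ (*-monoʳ-≤ 4 (*-monoʳ-≤ M M≤q))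
                                                   (*-monoʳ-≤ (2 * M) a+b≤q+1)) ab≤q ⟩
  4 * (M * q) + 2 * M * (q + 1) + q          ≡⟨ solve (M ∷ q ∷ []) ⟩
  6 * (M * q) + (2 * M + q)                  ≤⟨ +-monoʳ-≤ (6 * (M * q)) (m+n≤m*n (*-monoʳ-≤ 2 1≤M) 2≤q) ⟩
  6 * (M * q) + 2 * M * q                    ≡⟨ solve (M ∷ q ∷ []) ⟩
  8 * (M * q)                                ∎
  where
  open ≤-Reasoning
  a+b≤q+1 : a + b ≤ q + 1
  a+b≤q+1 = ≤-trans (m+n≤m*n+1 1≤a 1≤b) (+-monoˡ-≤ 1 ab≤q)

∣m*n⇒∃-split : ∀ {q m n} .{{_ : NonZero q}} → q ∣ m * n → ∃ λ d → ∃ λ e → d * e ≡ q × d ∣ m × e ∣ n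
∣m*n⇒∃-split {q} {m} {n} q∣mn = g , q / g , g*[q/g]≡q , gcd[m,n]∣m m q , q/g∣n
  where
  g : ℕ
  g = gcd m q
  instance
    g≢0 : NonZero g
    g≢0 = ≢-nonZero (gcd[m,n]≢0 m q (inj₂ (≢-nonZero⁻¹ q)))
  g*[q/g]≡q : g * (q / g) ≡ q
  g*[q/g]≡q = m*[n/m]≡n (gcd[m,n]∣n m q)
  mn≡ : m * n ≡ g * (m / g * n)
  mn≡ = begin
    m * n            ≡⟨ cong (_* n) (m*[n/m]≡n (gcd[m,n]∣m m q)) ⟨
    g * (m / g) * n  ≡⟨ *-assoc g (m / g) n ⟩
    g * (m / g * n)  ∎
    where open ≡-Reasoning
  q/g∣n : q / g ∣ n
  q/g∣n = coprime-divisor (Coprime.sym (coprime-/gcd m q))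
            (*-cancelˡ-∣ g (subst₂ _∣_ (sym g*[q/g]≡q) mn≡ q∣mn))

∣m*n*o⇒∃-split : ∀ {q m n o} .{{_ : NonZero q}} → q ∣ m * n * o →
  ∃ λ d₁ → ∃ λ d₂ → ∃ λ d₃ → d₁ * d₂ * d₃ ≡ q × d₁ ∣ m × d₂ ∣ n × d₃ ∣ o
∣m*n*o⇒∃-split {q} {m} {n} {o} q∣mno
  with d₁ , e , d₁e≡q , d₁∣m , e∣no ← ∣m*n⇒∃-split (subst (q ∣_) (*-assoc m n o) q∣mno)
  with d₂ , d₃ , d₂d₃≡e , d₂∣n , d₃∣o ← ∣m*n⇒∃-split {{m*n≡o⇒n≢0 d₁ d₁e≡q}} e∣no =
  d₁ , d₂ , d₃ , trans (*-assoc d₁ d₂ d₃) (trans (cong (d₁ *_) d₂d₃≡e) d₁e≡q) , d₁∣m , d₂∣n , d₃∣o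

positiveMultiples : ℕ → ℕ → List ℕ
positiveMultiples zero      L = []
positiveMultiples d@(suc _) L = map (λ k → d * suc k) (upTo (L / d))

∈-positiveMultiples : ∀ {d v L} → d ∣ v → 0 < v → v ≤ L → v ∈ positiveMultiples d L
∈-positiveMultiples {zero} (divides k refl) 0<k*0 _ = contradiction (*-zeroʳ k) (>⇒≢ 0<k*0)
∈-positiveMultiples {suc _} (divides zero refl) () _
∈-positiveMultiples {d@(suc _)} {L = L} (divides (suc k) refl) _ v≤L =
  subst (_∈ positiveMultiples d L) (*-comm d (suc k))
    (∈-map⁺ (λ k → d * suc k) (∈-upTo⁺ (m*n≤o⇒m≤o/n (suc k) v≤L)))

length-positiveMultiples : ∀ d L → length (positiveMultiples d L) * d ≤ L
length-positiveMultiples zero      L = z≤n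
length-positiveMultiples d@(suc _) L =
  subst (λ n → n * d ≤ L) (sym (trans (length-map _ (upTo (L / d))) (length-upTo (L / d)))) (m/n*n≤m L d)

congruentUpTo : ℕ → ℕ → ℕ → List ℕ
congruentUpTo L zero      r = []
congruentUpTo L d@(suc _) r = map (λ k → r % d + d * k) (upTo (suc (L / d)))

∈-congruentUpTo : ∀ {d v r L} .{{_ : NonZero d}} → v ≡ r [mod d ] → v ≤ L → v ∈ congruentUpTo L d r
∈-congruentUpTo {d@(suc _)} {v} {r} {L} v≡r v≤L =
  subst (_∈ congruentUpTo L d r) v≡ (∈-map⁺ (λ k → r % d + d * k) (∈-upTo⁺ (s≤s (/-monoˡ-≤ d v≤L))))
  where
  v≡ : r % d + d * (v / d) ≡ v
  v≡ = begin
    r % d + d * (v / d)  ≡⟨ cong₂ _+_ (sym v≡r) (*-comm d (v / d)) ⟩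
    v % d + v / d * d    ≡⟨ m≡m%n+[m/n]*n v d ⟨
    v                    ∎
    where open ≡-Reasoning

length-congruentUpTo : ∀ L d r → length (congruentUpTo L d r) * d ≤ L + d
length-congruentUpTo L zero      r = z≤n
length-congruentUpTo L d@(suc _) r =
  subst (λ n → n * d ≤ L + d) (sym (trans (length-map _ (upTo (suc (L / d)))) (length-upTo (suc (L / d)))))
    (subst (_≤ L + d) (+-comm (L / d * d) d) (+-monoˡ-≤ d (m/n*n≤m L d)))

+∸-≡[mod] : ∀ {d x y M} .{{_ : NonZero d}} → x ≤ M → d ∣ ∣ y - x ∣ → (y + M ∸ x) ≡ M [mod d ]
+∸-≡[mod] {d} {x} {y} {M} x≤M d∣∣y-x∣ with ≤-total x y
... | inj₁ x≤y = begin
  (y + M ∸ x) % d    ≡⟨ cong (_% d) (trans (+-∸-comm M x≤y) (+-comm (y ∸ x) M)) ⟩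
  (M + (y ∸ x)) % d  ≡⟨ %-remove-+ʳ M (subst (d ∣_) (m≤n⇒∣n-m∣≡n∸m x≤y) d∣∣y-x∣) ⟩
  M % d              ∎
  where open ≡-Reasoning
... | inj₂ y≤x = sym (begin
  M % d                          ≡⟨ cong (_% d) M≡ ⟨
  ((y + M ∸ x) + (x ∸ y)) % d    ≡⟨ %-remove-+ʳ (y + M ∸ x) (subst (d ∣_) (m≤n⇒∣m-n∣≡n∸m y≤x) d∣∣y-x∣) ⟩
  (y + M ∸ x) % d                ∎)
  where
  open ≡-Reasoning
  M≡ : (y + M ∸ x) + (x ∸ y) ≡ M
  M≡ = begin
    (y + M ∸ x) + (x ∸ y)              ≡⟨ cong (λ z → (y + M ∸ z) + (x ∸ y)) (m+[n∸m]≡n y≤x) ⟨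
    (y + M ∸ (y + (x ∸ y))) + (x ∸ y)  ≡⟨ cong (_+ (x ∸ y)) ([m+n]∸[m+o]≡n∸o y M (x ∸ y)) ⟩
    (M ∸ (x ∸ y)) + (x ∸ y)            ≡⟨ m∸n+n≡m (≤-trans (m∸n≤m x y) x≤M) ⟩
    M                                  ∎

≡[mod]⇒∣- : ∀ {a b q} .{{_ : NonZero q}} → a ≡ b [mod q ] → + q ℤ.∣ + a ℤ.- + b
≡[mod]⇒∣- {a} {b} {q} a≡b = ℤ.divides (+ (a / q) ℤ.- + (b / q)) (begin
  + a ℤ.- + b                                      ≡⟨ cong₂ ℤ._-_ (split a) (split b) ⟩
  (+ (a % q) ℤ.+ + (a / q) ℤ.* + q) ℤ.- (+ (b % q) ℤ.+ + (b / q) ℤ.* + q)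
    ≡⟨ cong (λ r → (+ (a % q) ℤ.+ + (a / q) ℤ.* + q) ℤ.- (+ r ℤ.+ + (b / q) ℤ.* + q)) (sym a≡b) ⟩
  (+ (a % q) ℤ.+ + (a / q) ℤ.* + q) ℤ.- (+ (a % q) ℤ.+ + (b / q) ℤ.* + q)
    ≡⟨ cancel (+ (a % q)) (+ (a / q)) (+ (b / q)) (+ q) ⟩
  (+ (a / q) ℤ.- + (b / q)) ℤ.* + q                ∎)
  where
  open ≡-Reasoning
  split : ∀ n → + n ≡ + (n % q) ℤ.+ + (n / q) ℤ.* + q
  split n = trans (cong +_ (m≡m%n+[m/n]*n n q))
                  (trans (pos-+ (n % q) _) (cong (λ t → + (n % q) ℤ.+ t) (pos-* (n / q) q)))
  cancel : ∀ r s t u → (r ℤ.+ s ℤ.* u) ℤ.- (r ℤ.+ t ℤ.* u) ≡ (s ℤ.- t) ℤ.* u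
  cancel = ℤ-Solver.solve-∀

∣+m-+n∣≡∣m-n∣ : ∀ m n → ℤ.∣ + m ℤ.- + n ∣ ≡ ∣ m - n ∣
∣+m-+n∣≡∣m-n∣ m n with ≤-total m n
... | inj₁ m≤n = begin
  ℤ.∣ + m ℤ.- + n ∣  ≡⟨ cong ℤ.∣_∣ (m-n≡m⊖n m n) ⟩
  ℤ.∣ m ⊖ n ∣        ≡⟨ ∣⊖∣-≤ m≤n ⟩
  n ∸ m              ≡⟨ m≤n⇒∣m-n∣≡n∸m m≤n ⟨
  ∣ m - n ∣          ∎
  where open ≡-Reasoning
... | inj₂ n≤m = begin
  ℤ.∣ + m ℤ.- + n ∣  ≡⟨ cong ℤ.∣_∣ (m-n≡m⊖n m n) ⟩
  ℤ.∣ m ⊖ n ∣        ≡⟨ ∣m⊖n∣≡∣n⊖m∣ m n ⟩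
  ℤ.∣ n ⊖ m ∣        ≡⟨ ∣⊖∣-≤ n≤m ⟩
  m ∸ n              ≡⟨ m≤n⇒∣n-m∣≡n∸m n≤m ⟨
  ∣ m - n ∣          ∎
  where open ≡-Reasoning

key-identity : ∀ x₁ x₂ y₁ y₂ u₁ u₂ v₁ v₂ →
  (x₁ ℤ.+ x₂) ℤ.* (y₁ ℤ.- x₁) ℤ.* (x₂ ℤ.- y₁) ≡
    (x₁ ℤ.* x₂ ℤ.* y₁ ℤ.* y₂) ℤ.* ((u₁ ℤ.+ u₂) ℤ.- (v₁ ℤ.+ v₂))
    ℤ.- (x₂ ℤ.* y₁ ℤ.* y₂) ℤ.* (x₁ ℤ.* u₁ ℤ.- 1ℤ)
    ℤ.- (x₁ ℤ.* y₁ ℤ.* y₂) ℤ.* (x₂ ℤ.* u₂ ℤ.- 1ℤ)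
    ℤ.+ (x₁ ℤ.* x₂ ℤ.* y₂) ℤ.* (y₁ ℤ.* v₁ ℤ.- 1ℤ)
    ℤ.+ (x₁ ℤ.* x₂ ℤ.* y₁) ℤ.* (y₂ ℤ.* v₂ ℤ.- 1ℤ)
    ℤ.+ ((x₁ ℤ.+ x₂) ℤ.* y₁ ℤ.- x₁ ℤ.* x₂) ℤ.* ((x₁ ℤ.+ x₂) ℤ.- (y₁ ℤ.+ y₂))
key-identity = ℤ-Solver.solve-∀

∣[x₁+x₂][y₁-x₁][x₂-y₁] : ∀ {q : ℤ} x₁ x₂ y₁ y₂ u₁ u₂ v₁ v₂ →
  q ℤ.∣ x₁ ℤ.* u₁ ℤ.- 1ℤ → q ℤ.∣ x₂ ℤ.* u₂ ℤ.- 1ℤ → q ℤ.∣ y₁ ℤ.* v₁ ℤ.- 1ℤ → q ℤ.∣ y₂ ℤ.* v₂ ℤ.- 1ℤ →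
  q ℤ.∣ (u₁ ℤ.+ u₂) ℤ.- (v₁ ℤ.+ v₂) → q ℤ.∣ (x₁ ℤ.+ x₂) ℤ.- (y₁ ℤ.+ y₂) →
  q ℤ.∣ (x₁ ℤ.+ x₂) ℤ.* (y₁ ℤ.- x₁) ℤ.* (x₂ ℤ.- y₁)
∣[x₁+x₂][y₁-x₁][x₂-y₁] {q} x₁ x₂ y₁ y₂ u₁ u₂ v₁ v₂ q∣x₁u₁ q∣x₂u₂ q∣y₁v₁ q∣y₂v₂ q∣u q∣x =
  subst (q ℤ.∣_) (sym (key-identity x₁ x₂ y₁ y₂ u₁ u₂ v₁ v₂))
    (∣m∣n⇒∣m+n (∣m∣n⇒∣m+n (∣m∣n⇒∣m+n (∣m∣n⇒∣m-n (∣m∣n⇒∣m-n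
      (∣n⇒∣m*n (x₁ ℤ.* x₂ ℤ.* y₁ ℤ.* y₂) q∣u) (∣n⇒∣m*n (x₂ ℤ.* y₁ ℤ.* y₂) q∣x₁u₁))
      (∣n⇒∣m*n (x₁ ℤ.* y₁ ℤ.* y₂) q∣x₂u₂)) (∣n⇒∣m*n (x₁ ℤ.* x₂ ℤ.* y₂) q∣y₁v₁))
      (∣n⇒∣m*n (x₁ ℤ.* x₂ ℤ.* y₁) q∣y₂v₂)) (∣n⇒∣m*n ((x₁ ℤ.+ x₂) ℤ.* y₁ ℤ.- x₁ ℤ.* x₂) q∣x))

module _ {q : ℕ} .{{_ : NonZero q}} where

  *-%-congʳ : ∀ x a → (x * (a % q)) ≡ (x * a) [mod q ]
  *-%-congʳ x a = begin
    (x * (a % q)) % q              ≡⟨ %-distribˡ-* x (a % q) q ⟩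
    ((x % q) * (a % q % q)) % q    ≡⟨ cong (λ t → ((x % q) * t) % q) (m%n%n≡m%n a q) ⟩
    ((x % q) * (a % q)) % q        ≡⟨ %-distribˡ-* x a q ⟨
    (x * a) % q                    ∎
    where open ≡-Reasoning

  invSearch-complete : ∀ x k y z → y ≤ z → z < y + k → (x * z) ≡ 1 [mod q ] →
                       (x * invSearch q x y k) ≡ 1 [mod q ]
  invSearch-complete x zero y z y≤z z<y+0 _ =
    contradiction (subst (_≤ z) (sym (+-identityʳ y)) y≤z) (<⇒≱ z<y+0)
  invSearch-complete x (suc k) y z y≤z z<y+1+k xz≡1 with (x * y) % q ≟ 1 % q
  ... | yes xy≡1 = xy≡1
  ... | no xy≢1 with m≤n⇒m<n∨m≡n y≤z
  ...   | inj₂ refl = contradiction xz≡1 xy≢1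
  ...   | inj₁ y<z  = invSearch-complete x k (suc y) z y<z (subst (z <_) (+-suc y k) z<y+1+k) xz≡1

  inverse-exists : ∀ {x} → Coprime x q → ∃ λ z → (x * z) ≡ 1 [mod q ]
  inverse-exists {x} x⊥q with coprime-Bézout x⊥q
  ... | Bézout.+- a b 1+bq≡ax = a , (begin
    (x * a) % q      ≡⟨ cong (_% q) (trans (*-comm x a) (sym 1+bq≡ax)) ⟩
    (1 + b * q) % q  ≡⟨ [m+kn]%n≡m%n 1 b q ⟩
    1 % q            ∎)
    where open ≡-Reasoning
  -- here −a is an inverse of x, hence so is a (q − 1)
  ... | Bézout.-+ a b 1+ax≡bq = a * pred q , (begin
    (x * (a * pred q)) % q          ≡⟨ [m+kn]%n≡m%n (x * (a * pred q)) 1 q ⟨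
    (x * (a * pred q) + 1 * q) % q  ≡⟨ cong (_% q) shifted ⟩
    (1 + (b * pred q) * q) % q      ≡⟨ [m+kn]%n≡m%n 1 (b * pred q) q ⟩
    1 % q                           ∎)
    where
    open ≡-Reasoning
    shift : ∀ p → 1 + a * x ≡ b * suc p → x * (a * p) + 1 * suc p ≡ 1 + (b * p) * suc p
    shift p eq = begin
      x * (a * p) + 1 * suc p  ≡⟨ solve (x ∷ a ∷ p ∷ []) ⟩
      (1 + a * x) * p + 1      ≡⟨ cong (λ t → t * p + 1) eq ⟩
      b * suc p * p + 1        ≡⟨ solve (b ∷ p ∷ []) ⟩
      1 + (b * p) * suc p      ∎
    shifted : x * (a * pred q) + 1 * q ≡ 1 + (b * pred q) * q
    shifted = subst (λ n → x * (a * pred q) + 1 * n ≡ 1 + (b * pred q) * n) (suc-pred q)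
                (shift (pred q) (subst (λ n → 1 + a * x ≡ b * n) (sym (suc-pred q)) 1+ax≡bq))

  inv-inverse : ∀ {x} → Coprime x q → (x * inv q x) ≡ 1 [mod q ]
  inv-inverse {x} x⊥q with inverse-exists x⊥q
  ... | z , xz≡1 = invSearch-complete x q 0 (z % q) z≤n (m%n<n z q)
                     (trans (*-%-congʳ x z) xz≡1)

  +-cancelˡ-≡[mod] : ∀ y {a b} → (y + a) ≡ (y + b) [mod q ] → 0 < a → a ≤ q → 0 < b → b ≤ q → a ≡ b
  +-cancelˡ-≡[mod] y {suc a} {suc b} eq _ a<q _ b<q =
    ∣m-n∣≡0⇒m≡n (m∣n∧n<m⇒n≡0 q∣∣a-b∣ (≤-<-trans (∣m-n∣≤m⊔n a b) (⊔-lub a<q b<q)))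
    where
    cancel : ∀ y a b → (y ℤ.+ a) ℤ.- (y ℤ.+ b) ≡ a ℤ.- b
    cancel = ℤ-Solver.solve-∀
    difference : + (y + suc a) ℤ.- + (y + suc b) ≡ + suc a ℤ.- + suc b
    difference = trans (cong₂ ℤ._-_ (pos-+ y (suc a)) (pos-+ y (suc b))) (cancel (+ y) (+ suc a) (+ suc b))
    q∣∣a-b∣ : q ∣ ∣ a - b ∣
    q∣∣a-b∣ = subst (q ∣_) (∣+m-+n∣≡∣m-n∣ (suc a) (suc b)) (∣⇒∣ᵤ (subst (λ t → + q ℤ.∣ t) difference (≡[mod]⇒∣- eq)))

  Sol⇒∣ : ∀ {x₁ x₂ y₁ y₂} → Sol q (x₁ , x₂ , y₁ , y₂) →
          q ∣ (x₁ + x₂) * ∣ y₁ - x₁ ∣ * ∣ x₂ - y₁ ∣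
  Sol⇒∣ {x₁} {x₂} {y₁} {y₂} (((x₁⊥q , x₂⊥q) , (y₁⊥q , y₂⊥q)) , (inv-sums , sums)) =
    subst (q ∣_) abs-product (∣⇒∣ᵤ (∣[x₁+x₂][y₁-x₁][x₂-y₁] (+ x₁) (+ x₂) (+ y₁) (+ y₂)
      (+ inv q x₁) (+ inv q x₂) (+ inv q y₁) (+ inv q y₂)
      (inverse⇒∣ x₁⊥q) (inverse⇒∣ x₂⊥q) (inverse⇒∣ y₁⊥q) (inverse⇒∣ y₂⊥q)
      (sums⇒∣ (inv q x₁) (inv q x₂) (inv q y₁) (inv q y₂) inv-sums) (sums⇒∣ x₁ x₂ y₁ y₂ sums)))
    where
    inverse⇒∣ : ∀ {x} → Coprime x q → + q ℤ.∣ + x ℤ.* + inv q x ℤ.- 1ℤ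
    inverse⇒∣ {x} x⊥q = subst (λ t → + q ℤ.∣ t ℤ.- 1ℤ) (pos-* x (inv q x)) (≡[mod]⇒∣- (inv-inverse x⊥q))
    sums⇒∣ : ∀ a b c d → (a + b) ≡ (c + d) [mod q ] → + q ℤ.∣ (+ a ℤ.+ + b) ℤ.- (+ c ℤ.+ + d)
    sums⇒∣ a b c d eq = subst₂ (λ s t → + q ℤ.∣ s ℤ.- t) (pos-+ a b) (pos-+ c d) (≡[mod]⇒∣- eq)
    abs-product : ℤ.∣ (+ x₁ ℤ.+ + x₂) ℤ.* (+ y₁ ℤ.- + x₁) ℤ.* (+ x₂ ℤ.- + y₁) ∣ ≡
                  (x₁ + x₂) * ∣ y₁ - x₁ ∣ * ∣ x₂ - y₁ ∣
    abs-product = begin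
      ℤ.∣ (+ x₁ ℤ.+ + x₂) ℤ.* (+ y₁ ℤ.- + x₁) ℤ.* (+ x₂ ℤ.- + y₁) ∣
        ≡⟨ abs-* ((+ x₁ ℤ.+ + x₂) ℤ.* (+ y₁ ℤ.- + x₁)) (+ x₂ ℤ.- + y₁) ⟩
      ℤ.∣ (+ x₁ ℤ.+ + x₂) ℤ.* (+ y₁ ℤ.- + x₁) ∣ * ℤ.∣ + x₂ ℤ.- + y₁ ∣
        ≡⟨ cong₂ _*_ (abs-* (+ x₁ ℤ.+ + x₂) (+ y₁ ℤ.- + x₁)) (∣+m-+n∣≡∣m-n∣ x₂ y₁) ⟩
      ℤ.∣ + x₁ ℤ.+ + x₂ ∣ * ℤ.∣ + y₁ ℤ.- + x₁ ∣ * ∣ x₂ - y₁ ∣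
        ≡⟨ cong₂ (λ s t → ℤ.∣ s ∣ * t * ∣ x₂ - y₁ ∣) (sym (pos-+ x₁ x₂)) (∣+m-+n∣≡∣m-n∣ y₁ x₁) ⟩
      (x₁ + x₂) * ∣ y₁ - x₁ ∣ * ∣ x₂ - y₁ ∣ ∎
      where open ≡-Reasoning

-- The differences y₁ − xᵢ are shifted by M to stay in ℕ.
encode : ℕ → ℕ × ℕ × ℕ × ℕ → ℕ × ℕ × ℕ
encode M (x₁ , x₂ , y₁ , y₂) = x₁ + x₂ , y₁ + M ∸ x₁ , y₁ + M ∸ x₂

encode-injective : ∀ {M x₁ x₂ y₁ y₂ x₁′ x₂′ y₁′ y₂′} → x₁ ≤ M → x₂ ≤ M → x₁′ ≤ M → x₂′ ≤ M →
  encode M (x₁ , x₂ , y₁ , y₂) ≡ encode M (x₁′ , x₂′ , y₁′ , y₂′) → x₁ ≡ x₁′ × x₂ ≡ x₂′ × y₁ ≡ y₁′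
encode-injective {M} {x₁} {x₂} {y₁} {_} {x₁′} {x₂′} {y₁′} x₁≤M x₂≤M x₁′≤M x₂′≤M eq
  with s≡ , eq′ ← ,-injective eq with a≡ , b≡ ← ,-injective eq′ =
  +-cancelˡ-≡ a x₁ x₁′ (trans (recover x₁≤M) (trans t≡t′ (sym (trans (cong (_+ x₁′) a≡) (recover x₁′≤M))))) ,
  +-cancelˡ-≡ b x₂ x₂′ (trans (recover x₂≤M) (trans t≡t′ (sym (trans (cong (_+ x₂′) b≡) (recover x₂′≤M))))) ,
  +-cancelʳ-≡ M y₁ y₁′ t≡t′
  where
  a b : ℕ
  a = y₁ + M ∸ x₁
  b = y₁ + M ∸ x₂
  recover : ∀ {x y} → x ≤ M → (y + M ∸ x) + x ≡ y + M
  recover {x} {y} x≤M = m∸n+n≡m (≤-trans x≤M (m≤n+m M y))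
  twice : ∀ {y x x′} → x ≤ M → x′ ≤ M → 2 * (y + M) ≡ (y + M ∸ x) + (y + M ∸ x′) + (x + x′)
  twice {y} {x} {x′} x≤M x′≤M = begin
    2 * (y + M)                                   ≡⟨ solve (y ∷ M ∷ []) ⟩
    (y + M) + (y + M)                             ≡⟨ cong₂ _+_ (recover x≤M) (recover x′≤M) ⟨
    ((y + M ∸ x) + x) + ((y + M ∸ x′) + x′)        ≡⟨ interchange +-commutativeSemigroup (y + M ∸ x) x (y + M ∸ x′) x′ ⟩
    (y + M ∸ x) + (y + M ∸ x′) + (x + x′)          ∎
    where open ≡-Reasoning
  t≡t′ : y₁ + M ≡ y₁′ + M
  t≡t′ = *-cancelˡ-≡ (y₁ + M) (y₁′ + M) 2 (begin
    2 * (y₁ + M)       ≡⟨ twice x₁≤M x₂≤M ⟩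
    a + b + (x₁ + x₂)  ≡⟨ cong₂ _+_ (cong₂ _+_ a≡ b≡) s≡ ⟩
    _                  ≡⟨ twice x₁′≤M x₂′≤M ⟨
    2 * (y₁′ + M)      ∎)
    where open ≡-Reasoning

box : ℕ → ℕ × ℕ × ℕ → List (ℕ × ℕ × ℕ)
box M (d₁ , d₂ , d₃) = cartesianProduct (positiveMultiples d₁ (2 * M))
                         (cartesianProduct (congruentUpTo (2 * M) d₂ M) (congruentUpTo (2 * M) d₃ M))

length-box : ∀ {M q d₁ d₂ d₃} → d₁ * d₂ * d₃ ≡ q → 1 ≤ M → M ≤ q → 2 ≤ q →
             length (box M (d₁ , d₂ , d₃)) ≤ 16 * (M * M)
length-box {M} {q} {d₁} {d₂} {d₃} d₁d₂d₃≡q 1≤M M≤q 2≤q = *-cancelʳ-≤ _ _ q (begin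
  length (box M (d₁ , d₂ , d₃)) * q
    ≡⟨ cong (_* q) (trans (length-cartesianProduct P₁ (cartesianProduct P₂ P₃))
                          (cong (n₁ *_) (length-cartesianProduct P₂ P₃))) ⟩
  n₁ * (n₂ * n₃) * q                      ≡⟨ cong (n₁ * (n₂ * n₃) *_) d₁d₂d₃≡q ⟨
  n₁ * (n₂ * n₃) * (d₁ * d₂ * d₃)         ≡⟨ regroup n₁ n₂ n₃ d₁ d₂ d₃ ⟩
  n₁ * d₁ * (n₂ * d₂ * (n₃ * d₃))         ≤⟨ *-mono-≤ (length-positiveMultiples d₁ (2 * M))
                                               (*-mono-≤ (length-congruentUpTo (2 * M) d₂ M)
                                                         (length-congruentUpTo (2 * M) d₃ M)) ⟩
  2 * M * ((2 * M + d₂) * (2 * M + d₃))   ≤⟨ *-monoʳ-≤ (2 * M) ([2M+a]*[2M+b]≤8Mq 1≤d₂ 1≤d₃ d₂d₃≤q 1≤M M≤q 2≤q) ⟩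
  2 * M * (8 * (M * q))                   ≡⟨ solve (M ∷ q ∷ []) ⟩
  16 * (M * M) * q                        ∎)
  where
  open ≤-Reasoning
  P₁ P₂ P₃ : List ℕ
  P₁ = positiveMultiples d₁ (2 * M)
  P₂ = congruentUpTo (2 * M) d₂ M
  P₃ = congruentUpTo (2 * M) d₃ M
  n₁ n₂ n₃ : ℕ
  n₁ = length P₁
  n₂ = length P₂
  n₃ = length P₃
  regroup : ∀ a b c x y z → a * (b * c) * (x * y * z) ≡ a * x * (b * y * (c * z))
  regroup = solve-∀
  instance
    q≢0 : NonZero q
    q≢0 = >-nonZero (≤-trans (s≤s z≤n) 2≤q)
  d₂d₃≡ : d₁ * (d₂ * d₃) ≡ q
  d₂d₃≡ = trans (sym (*-assoc d₁ d₂ d₃)) d₁d₂d₃≡q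
  d₂d₃≤q : d₂ * d₃ ≤ q
  d₂d₃≤q = subst (d₂ * d₃ ≤_) d₂d₃≡ (m≤n*m (d₂ * d₃) d₁ {{m*n≡o⇒m≢0 d₁ d₂d₃≡}})
  1≤d₂ : 1 ≤ d₂
  1≤d₂ = >-nonZero⁻¹ d₂ {{m*n≢0⇒m≢0 d₂ {{m*n≡o⇒n≢0 d₁ d₂d₃≡}}}}
  1≤d₃ : 1 ≤ d₃
  1≤d₃ = >-nonZero⁻¹ d₃ {{m*n≡o⇒n≢0 (d₁ * d₂) d₁d₂d₃≡q}}

∈-box : ∀ {M d₁ d₂ d₃ x₁ x₂ y₁} .{{_ : NonZero d₂}} .{{_ : NonZero d₃}} →
  0 < x₁ → x₁ ≤ M → x₂ ≤ M → y₁ ≤ M →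
  d₁ ∣ x₁ + x₂ → d₂ ∣ (∣ y₁ - x₁ ∣) → d₃ ∣ (∣ x₂ - y₁ ∣) →
  (x₁ + x₂ , y₁ + M ∸ x₁ , y₁ + M ∸ x₂) ∈ box M (d₁ , d₂ , d₃)
∈-box {M} {d₁} {d₂} {d₃} {x₁} {x₂} {y₁} 0<x₁ x₁≤M x₂≤M y₁≤M d₁∣ d₂∣ d₃∣ =
  ∈-cartesianProduct⁺ (∈-positiveMultiples {d₁} {x₁ + x₂} {2 * M} d₁∣ (<-≤-trans 0<x₁ (m≤m+n x₁ x₂)) (sum≤2M x₁≤M x₂≤M))
    (∈-cartesianProduct⁺
      (∈-congruentUpTo {d₂} {y₁ + M ∸ x₁} {M} {2 * M} (+∸-≡[mod] {d₂} {x₁} {y₁} {M} x₁≤M d₂∣) (sum∸≤2M {x₁} y₁≤M))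
      (∈-congruentUpTo {d₃} {y₁ + M ∸ x₂} {M} {2 * M}
        (+∸-≡[mod] {d₃} {x₂} {y₁} {M} x₂≤M (subst (d₃ ∣_) (∣-∣-comm x₂ y₁) d₃∣)) (sum∸≤2M {x₂} y₁≤M)))
  where
  sum≤2M : ∀ {x y} → x ≤ M → y ≤ M → x + y ≤ 2 * M
  sum≤2M {x} {y} x≤M y≤M = subst (x + y ≤_) (cong (λ t → M + t) (sym (+-identityʳ M))) (+-mono-≤ x≤M y≤M)
  sum∸≤2M : ∀ {x y} → y ≤ M → y + M ∸ x ≤ 2 * M
  sum∸≤2M {x} {y} y≤M = ≤-trans (m∸n≤m (y + M) x) (sum≤2M y≤M ≤-refl)

encodings : ℕ → ℕ → List (ℕ × ℕ × ℕ)
encodings M q = concatMap (box M) (factorisations q)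

length-encodings : ∀ {M q} → 1 ≤ M → M ≤ q → 2 ≤ q → length (encodings M q) ≤ τ₃ q * (16 * (M * M))
length-encodings {M} {q} 1≤M M≤q 2≤q = length-concatMap-≤ (16 * (M * M)) (factorisations q)
  (λ { {d₁ , d₂ , d₃} t∈ → length-box {M} {q} {d₁} {d₂} {d₃} (∈-factorisations⁻ t∈) 1≤M M≤q 2≤q })

Sol⇒∈-encodings : ∀ {M q x₁ x₂ y₁ y₂} .{{_ : NonZero q}} → 0 < x₁ → x₁ ≤ M → x₂ ≤ M → y₁ ≤ M →
  Sol q (x₁ , x₂ , y₁ , y₂) → encode M (x₁ , x₂ , y₁ , y₂) ∈ encodings M q
Sol⇒∈-encodings {M} {q} {x₁} {x₂} {y₁} {y₂} 0<x₁ x₁≤M x₂≤M y₁≤M sol =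
  let d₁ , d₂ , d₃ , d₁d₂d₃≡q , d₁∣ , d₂∣ , d₃∣ = ∣m*n*o⇒∃-split (Sol⇒∣ sol)
  in ∈-concatMap⁺ (box M) (lose (∈-factorisations⁺ {d₁} {d₂} {d₃} d₁d₂d₃≡q)
       (∈-box {M} {d₁} {d₂} {d₃} {x₁} {x₂} {y₁} {{m*n≢0⇒n≢0 d₁ {{m*n≡o⇒m≢0 (d₁ * d₂) d₁d₂d₃≡q}}}}
         {{m*n≡o⇒n≢0 (d₁ * d₂) d₁d₂d₃≡q}} 0<x₁ x₁≤M x₂≤M y₁≤M d₁∣ d₂∣ d₃∣))

module _ {q : ℕ} .{{_ : NonZero q}} {N N₁ : ℕ} (N₁≤q : N₁ ≤ q) where

  solutions : List (ℕ × ℕ × ℕ × ℕ)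
  solutions = filter (sol? q) (quads N N₁)

  ∈-solutions⁻ : ∀ {x₁ x₂ y₁ y₂} → (x₁ , x₂ , y₁ , y₂) ∈ solutions →
    ((N < x₁ × x₁ ≤ N₁) × (N < x₂ × x₂ ≤ N₁) × (N < y₁ × y₁ ≤ N₁) × (N < y₂ × y₂ ≤ N₁)) × Sol q (x₁ , x₂ , y₁ , y₂)
  ∈-solutions⁻ w∈ with w∈quads , sol ← ∈-filter⁻ (sol? q) {xs = quads N N₁} w∈
    with x₁∈ , x₂∈ , y₁∈ , y₂∈ ← ∈-quads⁻ w∈quads =
    (∈-range⁻ x₁∈ , ∈-range⁻ x₂∈ , ∈-range⁻ y₁∈ , ∈-range⁻ y₂∈) , sol

  encode-injectiveOn : ∀ {u v} → u ∈ solutions → v ∈ solutions → encode N₁ u ≡ encode N₁ v → u ≡ v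
  encode-injectiveOn {x₁ , x₂ , y₁ , y₂} {x₁′ , x₂′ , y₁′ , y₂′} u∈ v∈ eq
    with ((_ , x₁≤) , (_ , x₂≤) , _ , (N<y₂ , y₂≤)) , (_ , (_ , u-sums)) ← ∈-solutions⁻ u∈
    with ((_ , x₁′≤) , (_ , x₂′≤) , _ , (N<y₂′ , y₂′≤)) , (_ , (_ , v-sums)) ← ∈-solutions⁻ v∈
    with refl , refl , refl ← encode-injective {y₂ = y₂} {y₂′ = y₂′} x₁≤ x₂≤ x₁′≤ x₂′≤ eq =
    cong (λ y → x₁ , x₂ , y₁ , y) (+-cancelˡ-≡[mod] y₁ (trans (sym u-sums) v-sums)
      (≤-<-trans z≤n N<y₂) (≤-trans y₂≤ N₁≤q) (≤-<-trans z≤n N<y₂′) (≤-trans y₂′≤ N₁≤q))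

  encode-∈-encodings : ∀ {w} → w ∈ solutions → encode N₁ w ∈ encodings N₁ q
  encode-∈-encodings {x₁ , x₂ , y₁ , y₂} w∈ =
    let ((N<x₁ , x₁≤) , (_ , x₂≤) , (_ , y₁≤) , _) , sol = ∈-solutions⁻ w∈
    in Sol⇒∈-encodings (≤-<-trans z≤n N<x₁) x₁≤ x₂≤ y₁≤ sol

  I≤16τ₃N₁² : N < N₁ → 2 ≤ q → I q N N₁ ≤ τ₃ q * (16 * (N₁ * N₁))
  I≤16τ₃N₁² N<N₁ 2≤q = ≤-trans
    (length-≤-injectiveOn (filter⁺ (sol? q) (Unique-quads N N₁)) encode-∈-encodings encode-injectiveOn)
    (length-encodings (≤-<-trans z≤n N<N₁) N₁≤q 2≤q)

∃-prime-divisor : ∀ q → 2 ≤ q → ∃ λ p → Prime p × p ∣ q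
∃-prime-divisor q@(suc (suc _)) (s≤s (s≤s _)) with factorise q
... | record { factors = [] ; isFactorisation = () }
... | record { factors = p ∷ ps ; isFactorisation = q≡pΠps ; factorsPrime = p-prime All.∷ _ } =
  p , p-prime , subst (p ∣_) (sym q≡pΠps) (m∣m*n (product ps))

1≤ω : ∀ {q} → 2 ≤ q → 1 ≤ ω q
1≤ω {q@(suc _)} 2≤q with p , p-prime , p∣q ← ∃-prime-divisor q 2≤q =
  ∈⇒1≤length (∈-filter⁺ (λ p → prime? p ×-dec (p ∣? q)) (∈-applyUpTo⁺ (λ i → i) (s≤s (∣⇒≤ p∣q))) (p-prime , p∣q))

2≤2^ω : ∀ {q} → 2 ≤ q → 2 ≤ 2 ^ ω q
2≤2^ω 2≤q = ^-monoʳ-≤ 2 (1≤ω 2≤q)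

1≤τ₃ : ∀ q .{{_ : NonZero q}} → 1 ≤ τ₃ q
1≤τ₃ q = ∈⇒1≤length (∈-factorisations⁺ {1} {1} {q} (+-identityʳ q))

toℚ≡mkℚ : ∀ n → toℚ n ≡ mkℚ (+ n) 0 (Coprime.sym (1-coprimeTo n))
toℚ≡mkℚ n = normalize-coprime (Coprime.sym (1-coprimeTo n))

toℚ-* : ∀ m n → toℚ (m * n) ≡ toℚ m ℚ.* toℚ n
toℚ-* m n = trans (cong (ℚ._/ 1) (ℤ.pos-* m n)) (sym (cong₂ ℚ._*_ (toℚ≡mkℚ m) (toℚ≡mkℚ n)))

toℚ-*³ : ∀ a b c d → toℚ (a * (b * (c * d))) ≡ toℚ a ℚ.* (toℚ b ℚ.* (toℚ c ℚ.* toℚ d))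
toℚ-*³ a b c d = trans (toℚ-* a _) (cong (toℚ a ℚ.*_) (trans (toℚ-* b _) (cong (toℚ b ℚ.*_) (toℚ-* c d))))

toℚ-mono-≤ : ∀ {m n} → m ≤ n → toℚ m ℚ.≤ toℚ n
toℚ-mono-≤ {m} {n} m≤n rewrite toℚ≡mkℚ m | toℚ≡mkℚ n =
  *≤* (subst₂ ℤ._≤_ (sym (ℤ.*-identityʳ (+ m))) (sym (ℤ.*-identityʳ (+ n))) (+≤+ m≤n))

toℚ-mono-< : ∀ {m n} → m < n → toℚ m ℚ.< toℚ n
toℚ-mono-< {m} {n} m<n rewrite toℚ≡mkℚ m | toℚ≡mkℚ n =
  *<* (subst₂ ℤ._<_ (sym (ℤ.*-identityʳ (+ m))) (sym (ℤ.*-identityʳ (+ n))) (+<+ m<n))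

ℚ-ring : AlmostCommutativeRing 0ℓ 0ℓ
ℚ-ring = fromCommutativeRing +-*-commutativeRing (λ _ → nothing)

16tm²<[2c]³wtn² : ∀ {c t w n m} → 1ℚ ℚ.< c → 0ℚ ℚ.< t → toℚ 2 ℚ.≤ w → 0ℚ ℚ.< n → 0ℚ ℚ.≤ m → m ℚ.≤ c ℚ.* n →
  t ℚ.* (toℚ 16 ℚ.* (m ℚ.* m)) ℚ.< ((toℚ 2 ℚ.* c) ℚ.* (toℚ 2 ℚ.* c) ℚ.* (toℚ 2 ℚ.* c)) ℚ.* w ℚ.* t ℚ.* (n ℚ.* n)
16tm²<[2c]³wtn² {c} {t} {w} {n} {m} 1<c 0<t 2≤w 0<n 0≤m m≤cn = begin-strict
  t ℚ.* (toℚ 16 ℚ.* (m ℚ.* m))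
    ≤⟨ *-monoˡ-≤-nonNeg t (*-monoˡ-≤-nonNeg (toℚ 16) m²≤[cn]²) ⟩
  t ℚ.* (toℚ 16 ℚ.* [cn]²)
    <⟨ *-monoʳ-<-pos t (*-monoʳ-<-pos (toℚ 16) [cn]²<c[cn]²) ⟩
  t ℚ.* (toℚ 16 ℚ.* (c ℚ.* [cn]²))
    ≡⟨ regroup t (toℚ 2) c n ⟩
  [2c]³ ℚ.* toℚ 2 ℚ.* t ℚ.* (n ℚ.* n)
    ≤⟨ *-monoʳ-≤-nonNeg (n ℚ.* n) (*-monoʳ-≤-nonNeg t (*-monoˡ-≤-nonNeg [2c]³ 2≤w)) ⟩
  ((toℚ 2 ℚ.* c) ℚ.* (toℚ 2 ℚ.* c) ℚ.* (toℚ 2 ℚ.* c)) ℚ.* w ℚ.* t ℚ.* (n ℚ.* n) ∎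
  where
  open ℚ.≤-Reasoning
  [cn]² [2c]³ : ℚ
  [cn]² = (c ℚ.* n) ℚ.* (c ℚ.* n)
  [2c]³ = (toℚ 2 ℚ.* c) ℚ.* (toℚ 2 ℚ.* c) ℚ.* (toℚ 2 ℚ.* c)
  -- applied with a = toℚ 2, whose fourth power is toℚ 16 by computation
  regroup : ∀ t a c n → t ℚ.* ((a ℚ.* a ℚ.* a ℚ.* a) ℚ.* (c ℚ.* ((c ℚ.* n) ℚ.* (c ℚ.* n)))) ≡ ((a ℚ.* c) ℚ.* (a ℚ.* c) ℚ.* (a ℚ.* c)) ℚ.* a ℚ.* t ℚ.* (n ℚ.* n)
  regroup = Ring.solve-∀ ℚ-ring
  instance
    c>0 : Positive c
    c>0 = ℚ.positive (ℚ.<-trans (toℚ-mono-< {0} {1} (s≤s z≤n)) 1<c)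
    t>0 : Positive t
    t>0 = ℚ.positive 0<t
    n>0 : Positive n
    n>0 = ℚ.positive 0<n
    m≥0 : NonNegative m
    m≥0 = ℚ.nonNegative 0≤m
    t≥0 : NonNegative t
    t≥0 = pos⇒nonNeg t
    cn>0 : Positive (c ℚ.* n)
    cn>0 = pos*pos⇒pos c n
    cn≥0 : NonNegative (c ℚ.* n)
    cn≥0 = pos⇒nonNeg (c ℚ.* n)
    [cn]²>0 : Positive [cn]²
    [cn]²>0 = pos*pos⇒pos (c ℚ.* n) (c ℚ.* n)
    n²≥0 : NonNegative (n ℚ.* n)
    n²≥0 = pos⇒nonNeg (n ℚ.* n) {{pos*pos⇒pos n n}}
    2c>0 : Positive (toℚ 2 ℚ.* c)
    2c>0 = pos*pos⇒pos (toℚ 2) c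
    [2c]³≥0 : NonNegative [2c]³
    [2c]³≥0 = pos⇒nonNeg [2c]³ {{pos*pos⇒pos ((toℚ 2 ℚ.* c) ℚ.* (toℚ 2 ℚ.* c)) {{pos*pos⇒pos (toℚ 2 ℚ.* c) (toℚ 2 ℚ.* c)}} (toℚ 2 ℚ.* c)}}
  m²≤[cn]² : m ℚ.* m ℚ.≤ [cn]²
  m²≤[cn]² = ℚ.≤-trans (*-monoʳ-≤-nonNeg m m≤cn) (*-monoˡ-≤-nonNeg (c ℚ.* n) m≤cn)
  [cn]²<c[cn]² : [cn]² ℚ.< c ℚ.* [cn]²
  [cn]²<c[cn]² = subst (ℚ._< c ℚ.* [cn]²) (ℚ.*-identityˡ [cn]²) (*-monoˡ-<-pos [cn]² 1<c)

lemma3 : (c : ℚ) → toℚ 1 ℚ.< c →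
    Σ ℕ λ q₀ → (q : ℕ) → .{{_ : NonZero q}} → q₀ ≤ q →
      (N N₁ : ℕ) → N₁ ≤ q → 1 < N → N < N₁ → toℚ N₁ ℚ.≤ c ℚ.* toℚ N →
      toℚ (I q N N₁) ℚ.< ((toℚ 2 ℚ.* c) ℚ.* (toℚ 2 ℚ.* c) ℚ.* (toℚ 2 ℚ.* c)) ℚ.* toℚ (2 ^ ω q) ℚ.* toℚ (τ₃ q) ℚ.* (toℚ N ℚ.* toℚ N)
lemma3 c 1<c = 2 , λ q 2≤q N N₁ N₁≤q 1<N N<N₁ N₁≤cN → begin-strict
  toℚ (I q N N₁)                                     ≤⟨ toℚ-mono-≤ (I≤16τ₃N₁² N₁≤q N<N₁ 2≤q) ⟩
  toℚ (τ₃ q * (16 * (N₁ * N₁)))                      ≡⟨ toℚ-*³ (τ₃ q) 16 N₁ N₁ ⟩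
  toℚ (τ₃ q) ℚ.* (toℚ 16 ℚ.* (toℚ N₁ ℚ.* toℚ N₁))   <⟨ 16tm²<[2c]³wtn² 1<c (toℚ-mono-< (1≤τ₃ q)) (toℚ-mono-≤ (2≤2^ω 2≤q))
                                                          (toℚ-mono-< (<-trans (s≤s z≤n) 1<N)) (toℚ-mono-≤ {0} {N₁} z≤n) N₁≤cN ⟩
  ((toℚ 2 ℚ.* c) ℚ.* (toℚ 2 ℚ.* c) ℚ.* (toℚ 2 ℚ.* c)) ℚ.* toℚ (2 ^ ω q) ℚ.* toℚ (τ₃ q) ℚ.* (toℚ N ℚ.* toℚ N) ∎
  where open ℚ.≤-Reasoning
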